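{- Let $\pi\in\operatorname{Av}(231)^{+1}$. Then every essential entry of $\pi$ participates as the minimum entry either in all of the occurrences of $231$ in $\pi$ or in none of them.
   Context: A permutation $\pi$ contains $\sigma$ if $\pi$ has a subsequence order isomorphic to $\sigma$ (each such subsequence is an occurrence of $\sigma$); otherwise $\pi$ avoids $\sigma$. $\operatorname{Av}(231)$ is the class of $231$-avoiding permutations, and $\operatorname{Av}(231)^{+1}$ is the set of permutations from which one can remove at most one entry to obtain a $231$-avoiding permutation. An entry $\pi(i)$ of $\pi$ is called essential if removing it from $\pi$ results in a $231$-avoiding permutation (so if $\pi$ avoids $231$, every entry is essential). -}

module Defs where

open import Data.Nat using (ℕ)
open import Data.Fin using (Fin; _<_)
open import Data.Fin.Permutation using (Permutation′; _⟨$⟩ʳ_)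
open import Data.Product using (Σ; _×_; ∃-syntax)
open import Data.Sum using (_⊎_)
open import Relation.Binary.PropositionalEquality using (_≢_)
open import Relation.Nullary using (¬_)

Occ231 : ∀ {n} → Permutation′ n → Fin n → Fin n → Fin n → Set
Occ231 π i j k =
  (i < j) × (j < k) × ((π ⟨$⟩ʳ k) < (π ⟨$⟩ʳ i)) × ((π ⟨$⟩ʳ i) < (π ⟨$⟩ʳ j))

Avoids231 : ∀ {n} → Permutation′ n → Set
Avoids231 π = ¬ (∃[ i ] ∃[ j ] ∃[ k ] Occ231 π i j k)

-- Removing the entry at position p yields a 231-avoiding permutation:
-- the subsequence of π on the positions other than p has no occurrence
-- of 231 (pattern containment only depends on relative order, so this
-- is the same as the standardised permutation avoiding 231).
AvoidsWithout231 : ∀ {n} → Permutation′ n → Fin n → Set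
AvoidsWithout231 π p =
  ¬ (∃[ i ] ∃[ j ] ∃[ k ] (Occ231 π i j k × (i ≢ p) × (j ≢ p) × (k ≢ p)))

InAv231Plus1 : ∀ {n} → Permutation′ n → Set
InAv231Plus1 π = Avoids231 π ⊎ (∃[ p ] AvoidsWithout231 π p)

Essential : ∀ {n} → Permutation′ n → Fin n → Set
Essential π p = AvoidsWithout231 π p

module Submission where

-- If removing the entry at p destroys every occurrence of 231, then p lies
-- in every occurrence.  Suppose p is the "1" of some occurrence (a, b, p)
-- and sits at the "2" or "3" of another occurrence (i, j, k).  Then k lies
-- to the right of p and below it, so (a, b, k) is an occurrence of 231
-- avoiding p, a contradiction.

open import Defs
open import Data.Fin using (Fin; _<_)
open import Data.Fin.Permutation using (Permutation′; _⟨$⟩ʳ_)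
open import Data.Fin.Properties using (any?; _<?_; <-trans; <⇒≢; _≟_)
open import Data.Sum using (_⊎_; inj₁; inj₂)
open import Data.Product using (_×_; _,_)
open import Relation.Binary.PropositionalEquality using (_≡_; refl; sym)
open import Data.Empty using (⊥-elim)
open import Function using (_∘_)
open import Relation.Nullary using (¬_; Dec; yes; no; contradiction)
open import Relation.Nullary.Decidable using (_×-dec_)

module _ {n} (π : Permutation′ n) where

  occ231? : ∀ i j k → Dec (Occ231 π i j k)
  occ231? i j k =
    (i <? j) ×-dec (j <? k) ×-dec
    ((π ⟨$⟩ʳ k) <? (π ⟨$⟩ʳ i)) ×-dec ((π ⟨$⟩ʳ i) <? (π ⟨$⟩ʳ j))

  Occ231-replaceMin : ∀ {i j k l} → Occ231 π i j k →
    k < l → (π ⟨$⟩ʳ l) < (π ⟨$⟩ʳ k) → Occ231 π i j l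
  Occ231-replaceMin (i<j , j<k , πk<πi , πi<πj) k<l πl<πk =
    i<j , <-trans j<k k<l , <-trans πl<πk πk<πi , πi<πj

  Occ231-minAfter₁ : ∀ {i j k} → Occ231 π i j k →
    i < k × (π ⟨$⟩ʳ k) < (π ⟨$⟩ʳ i)
  Occ231-minAfter₁ (i<j , j<k , πk<πi , _) = <-trans i<j j<k , πk<πi

  Occ231-minAfter₂ : ∀ {i j k} → Occ231 π i j k →
    j < k × (π ⟨$⟩ʳ k) < (π ⟨$⟩ʳ j)
  Occ231-minAfter₂ (_ , j<k , πk<πi , πi<πj) = j<k , <-trans πk<πi πi<πj

  Essential-meetsOcc231 : ∀ {p i j k} → Essential π p → Occ231 π i j k →
    i ≡ p ⊎ j ≡ p ⊎ k ≡ p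
  Essential-meetsOcc231 {p} {i} {j} {k} ess occ with i ≟ p | j ≟ p | k ≟ p
  ... | yes i≡p | _       | _       = inj₁ i≡p
  ... | no _    | yes j≡p | _       = inj₂ (inj₁ j≡p)
  ... | no _    | no _    | yes k≡p = inj₂ (inj₂ k≡p)
  ... | no i≢p  | no j≢p  | no k≢p  =
    contradiction (i , j , k , occ , i≢p , j≢p , k≢p) ess

  Essential-min⇒noSmallerAfter : ∀ {p a b k} → Essential π p →
    Occ231 π a b p → ¬ (p < k × (π ⟨$⟩ʳ k) < (π ⟨$⟩ʳ p))
  Essential-min⇒noSmallerAfter ess occ@(a<b , b<p , _) (p<k , πk<πp) =
    ess (_ , _ , _ , Occ231-replaceMin occ p<k πk<πp ,
         <⇒≢ (<-trans a<b b<p) , <⇒≢ b<p , <⇒≢ p<k ∘ sym)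

  Essential-minOfOcc231⇒minOfAll : ∀ {p a b} → Essential π p →
    Occ231 π a b p → ∀ i j k → Occ231 π i j k → k ≡ p
  Essential-minOfOcc231⇒minOfAll ess occₚ i j k occ
    with Essential-meetsOcc231 ess occ
  ... | inj₁ refl =
    ⊥-elim (Essential-min⇒noSmallerAfter ess occₚ (Occ231-minAfter₁ occ))
  ... | inj₂ (inj₁ refl) =
    ⊥-elim (Essential-min⇒noSmallerAfter ess occₚ (Occ231-minAfter₂ occ))
  ... | inj₂ (inj₂ k≡p) = k≡p

-- The hypothesis InAv231Plus1 π is implied by Essential π p, hence unused.
proposition3p1 : ∀ {n} (π : Permutation′ n) → InAv231Plus1 π →
    ∀ (p : Fin n) → Essential π p →
      (∀ i j k → Occ231 π i j k → k ≡ p)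
      ⊎ (∀ i j k → Occ231 π i j k → ¬ (k ≡ p))
proposition3p1 π _ p ess with any? (λ a → any? (λ b → occ231? π a b p))
... | yes (_ , _ , occₚ) = inj₁ (Essential-minOfOcc231⇒minOfAll π ess occₚ)
... | no noOccₚ          = inj₂ λ { a b _ occ refl → noOccₚ (a , b , occ) }
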